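{- Let $G$ be a finite simple graph and let $I$ be a maximum critical independent set of $G$. Then for every maximum matching $M$ of $L_G$, \[ M\Bigl(N(I)-\bigl(\mathrm{corona}(G)-\partial_L(G)\bigr)\Bigr)\cup\ker(G)\subseteq \mathrm{nucleus}(G). \]
   Context: For $X\subseteq V(G)$, $N(X)$ is the union of neighborhoods of the vertices of $X$. $\Omega(G)$ is the family of maximum independent sets and $\mathrm{corona}(G)=\bigcup\Omega(G)$. An independent set $I$ of $G$ is critical if $|I|-|N(I)|\ge |J|-|N(J)|$ for every independent set $J$ of $G$; a maximum critical independent set is a critical independent set of maximum cardinality among critical independent sets. $\ker(G)$ is the intersection of all critical independent sets, and $\mathrm{nucleus}(G)$ the intersection of all maximum critical independent sets. $L(G)$ denotes the set $J\cup N(J)$ for any maximum critical independent set $J$ of $G$ (this set does not depend on the choice of $J$); $L^c(G)=V(G)-L(G)$, $L_G=G[L(G)]$, and $\partial_L(G)=\{v\in L(G):N(v)\cap L^c(G)\neq\emptyset\}$. For a matching $M$, $M(v)=u$ if $uv\in M$ and $M(v)=v$ otherwise; $M(S)=\{M(v):v\in S\}$. -}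

module Defs where

open import Data.Nat using (ℕ; _≤_; _+_)
open import Data.Bool using (Bool; true; false; T)
open import Data.Bool.Properties using (T?)
open import Data.Fin using (Fin; _≟_)
open import Data.Fin.Properties using (any?)
open import Data.Fin.Subset using (Subset; _∈_; _∉_; ∣_∣)
open import Data.Fin.Subset.Properties using (_∈?_)
open import Data.Vec using (tabulate)
open import Data.Product using (_×_; Σ; ∃; _,_)
open import Data.Sum using (_⊎_)
open import Relation.Nullary using (¬_; ¬?; _×-dec_)
open import Relation.Nullary.Decidable using (⌊_⌋)
open import Relation.Binary.PropositionalEquality using (_≡_; _≢_)

record Graph (n : ℕ) : Set where
  field
    adj    : Fin n → Fin n → Bool
    sym    : ∀ u v → adj u v ≡ adj v u
    irrefl : ∀ v → adj v v ≡ false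
open Graph public

module _ {n : ℕ} (G : Graph n) where

  Adj : Fin n → Fin n → Set
  Adj u v = T (adj G u v)

  N : Subset n → Subset n
  N X = tabulate (λ v → ⌊ any? (λ u → (u ∈? X) ×-dec T? (adj G u v)) ⌋)

  Independent : Subset n → Set
  Independent I = ∀ u v → u ∈ I → v ∈ I → ¬ Adj u v

  MaximumIndependent : Subset n → Set
  MaximumIndependent I =
    Independent I × (∀ J → Independent J → ∣ J ∣ ≤ ∣ I ∣)

  InCorona : Fin n → Set
  InCorona v = Σ (Subset n) (λ S → MaximumIndependent S × v ∈ S)

  -- critical: |I| - |N(I)| ≥ |J| - |N(J)| for all independent J (rearranged in ℕ)
  Critical : Subset n → Set
  Critical I = Independent I ×
    (∀ J → Independent J → ∣ J ∣ + ∣ N I ∣ ≤ ∣ I ∣ + ∣ N J ∣)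

  MaxCritical : Subset n → Set
  MaxCritical I = Critical I × (∀ J → Critical J → ∣ J ∣ ≤ ∣ I ∣)

  InKer : Fin n → Set
  InKer v = ∀ J → Critical J → v ∈ J

  InNucleus : Fin n → Set
  InNucleus v = ∀ J → MaxCritical J → v ∈ J

  InL : Subset n → Fin n → Set
  InL I v = v ∈ I ⊎ v ∈ N I

  InBoundaryL : Subset n → Fin n → Set
  InBoundaryL I v = InL I v × ∃ (λ u → Adj v u × ¬ InL I u)

  -- A matching M of L_G = G[L(G)], encoded by its partner map
  -- μ v = M(v) (the partner of v if v is matched, v itself otherwise).
  IsMatchingOfL : Subset n → (Fin n → Fin n) → Set
  IsMatchingOfL I μ =
    (∀ v → μ (μ v) ≡ v) ×
    (∀ v → μ v ≢ v → Adj v (μ v) × InL I v × InL I (μ v))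

  -- set of M-saturated vertices; its size is 2|M|
  Saturated : (Fin n → Fin n) → Subset n
  Saturated μ = tabulate (λ v → ⌊ ¬? (μ v ≟ v) ⌋)

  IsMaximumMatchingOfL : Subset n → (Fin n → Fin n) → Set
  IsMaximumMatchingOfL I μ = IsMatchingOfL I μ ×
    (∀ ν → IsMatchingOfL I ν → ∣ Saturated ν ∣ ≤ ∣ Saturated μ ∣)

  InImage : (Fin n → Fin n) → (Fin n → Set) → Fin n → Set
  InImage μ S w = Σ (Fin n) (λ v → S v × μ v ≡ w)

-- Write s(X) = |X| - |N(X)|. Critical sets are the independent maximisers of s, and they even
-- maximise s over all vertex sets, since s(X) ≤ s(X - N(X)). As |N| is submodular, s is
-- supermodular, so its maximisers are closed under union. For a maximum critical I and a critical J,
-- comparing I with I ∪ (X - N(X)), X = I ∪ J, then shows J ⊆ L = I ∪ N(I); for J maximum critical,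
-- also N(J) ⊆ L.
-- Criticality gives Hall's condition for N(I) towards I, so N(I) can be matched into I and a maximum
-- matching M of L_G saturates at least 2|N(I)| vertices. Since M matches the saturated vertices of
-- I into N(I), exactly |N(I)| vertices of I are saturated. For a maximum critical J we have |J| = |I|
-- and J ⊆ L, and counting forces M to send every vertex of N(I) - J into J. A vertex x ∈ N(I) ∩ J,
-- on the other hand, lies in corona(G) (critical sets extend to maximum independent sets) and not in
-- ∂_L(G), because N(x) ⊆ N(J) ⊆ L, so the hypothesis excludes it.
-- Finally ker(G) ⊆ nucleus(G) because maximum critical sets are critical.

{-# OPTIONS --safe #-}
module Submission where

open import Defs
open import Data.Nat using (ℕ)
open import Data.Fin using (Fin)
open import Data.Fin.Subset using (Subset; _∈_)
open import Data.Product using (_×_)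
open import Data.Sum using (_⊎_)
open import Relation.Nullary using (¬_)

open import Data.Bool using (T)
open import Data.Bool.Properties using (T?; T-≡)
open import Data.Fin using (zero; suc; _≟_)
open import Data.Fin.Properties using (suc-injective; 0≢1+n; any?; all?)
open import Data.Fin.Subset
  using (_∉_; _⊆_; _∩_; _∪_; _─_; _-_; ∣_∣; ⁅_⁆; ⊥; inside; outside; Nonempty; Empty)
open import Data.Fin.Subset.Properties
  using (_∈?_; _⊆?_; nonempty?; anySubset?; ∉⊥; x∈⁅x⁆; x∈⁅y⁆⇒x≡y; ∣⁅x⁆∣≡1; ∣p∣≤n; ∣⊥∣≡0;
         Empty-unique; ∩-comm; p─⊥≡p; p─q⊆p; p∩q⊆p; p∩q⊆q; p⊆p∪q; q⊆p∪q;
         x∈p∩q⁻; x∈p∩q⁺; x∈p∪q⁻; x∈p∪q⁺; x∈p∧x∉q⇒x∈p─q; x∈p∧x≢y⇒x∈p-y;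
         p⊆q⇒∣p∣≤∣q∣; p⊂q⇒∣p∣<∣q∣; x∈p⇒∣p-x∣<∣p∣; p∩q≢∅⇒∣p─q∣<∣p∣)
open import Data.Nat using (zero; suc; _+_; _∸_; _≤_; _<_; _<?_; _≤?_; z≤n; s≤s)
open import Data.Nat.Induction using (<-wellFounded)
open import Data.Nat.Properties
  using (≤-refl; ≤-reflexive; ≤-trans; ≤-antisym; ≤⇒≯; ≮⇒≥; ≰⇒>; ≤-pred; ≤-<-trans;
         m≤n⇒m≤1+n; m≤m+n; +-suc; +-identityʳ; +-assoc; +-commutativeSemigroup;
         +-mono-≤; +-monoˡ-≤; +-monoʳ-≤; +-cancelˡ-≤; +-cancelʳ-≤; +-cancelˡ-≡; ∸-monoʳ-<;
         module ≤-Reasoning)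
open import Data.Product using (∃-syntax; _,_; proj₁; proj₂)
import Data.Sum as Sum
open import Data.Sum using (inj₁; inj₂; [_,_]′)
open import Data.Vec.Properties using (lookup∘tabulate; []=⇒lookup; lookup⇒[]=)
open import Function using (_∘_; id)
open import Function.Bundles using (Equivalence)
open import Induction.WellFounded using (Acc; acc)
open import Relation.Binary.PropositionalEquality
  using (_≡_; _≢_; refl; trans; cong; subst; module ≡-Reasoning)
import Relation.Binary.PropositionalEquality as ≡
open import Relation.Nullary using (Dec; yes; no; ¬?; contradiction; _×-dec_; _→-dec_)
open import Relation.Nullary.Decidable using (⌊_⌋; toWitness; fromWitness)
open import Relation.Unary using (Pred; Decidable)
open import Algebra.Properties.CommutativeSemigroup +-commutativeSemigroup
  using (xy∙z≈y∙xz; xy∙z≈xz∙y; xy∙z≈x∙zy; xy∙z≈yz∙x)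

-- Inequalities between differences of naturals: a - b ≤ c - d is written a + d ≤ c + b.
module Arithmetic where

  open import Data.List.Base using (_∷_; [])
  open import Data.Nat.Tactic.RingSolver using (solve)
  open ≤-Reasoning

  diff-trans : ∀ {a b c d e f : ℕ} → a + d ≤ c + b → c + f ≤ e + d → a + f ≤ e + b
  diff-trans {a} {b} {c} {d} {e} {f} h₁ h₂ = +-cancelʳ-≤ (c + d) _ _ (begin
    (a + f) + (c + d) ≡⟨ solve (a ∷ c ∷ d ∷ f ∷ []) ⟩
    (a + d) + (c + f) ≤⟨ +-mono-≤ h₁ h₂ ⟩
    (c + b) + (e + d) ≡⟨ solve (b ∷ c ∷ d ∷ e ∷ []) ⟩
    (e + b) + (c + d) ∎)

  diff-supermodular : ∀ {i x y u k ni nx ny nu nk : ℕ} →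
    u + k ≡ x + y → nu + nk ≤ nx + ny →
    k + ni ≤ i + nk → i + nx ≤ x + ni → i + ny ≤ y + ni → i + nu ≤ u + ni
  diff-supermodular {i} {x} {y} {u} {k} {ni} {nx} {ny} {nu} {nk} sum nsum h₁ h₂ h₃ =
    +-cancelʳ-≤ (i + nk) _ _ (begin
      (i + nu) + (i + nk) ≡⟨ solve (i ∷ nu ∷ nk ∷ []) ⟩
      (i + i) + (nu + nk) ≤⟨ +-monoʳ-≤ (i + i) nsum ⟩
      (i + i) + (nx + ny) ≡⟨ solve (i ∷ nx ∷ ny ∷ []) ⟩
      (i + nx) + (i + ny) ≤⟨ +-mono-≤ h₂ h₃ ⟩
      (x + ni) + (y + ni) ≡⟨ solve (x ∷ y ∷ ni ∷ []) ⟩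
      (x + y) + (ni + ni) ≡⟨ cong (_+ (ni + ni)) (≡.sym sum) ⟩
      (u + k) + (ni + ni) ≡⟨ solve (u ∷ k ∷ ni ∷ []) ⟩
      (u + ni) + (k + ni) ≤⟨ +-monoʳ-≤ (u + ni) h₁ ⟩
      (u + ni) + (i + nk) ∎)

open Arithmetic

-- Imported only here: the calls to solve above need _∷_ to be unambiguously list cons.
open import Data.Vec.Base using (_∷_; []; here; there; tabulate)

private
  variable
    m n : ℕ
    x u v : Fin n
    p q A P Q X Y Z I J : Subset n

x∈p─q⇒x∉q : x ∈ p ─ q → x ∉ q
x∈p─q⇒x∉q {p = _ ∷ _} {q = inside ∷ _} () here
x∈p─q⇒x∉q {p = _ ∷ _} {q = _ ∷ _} (there x∈p─q) (there x∈q) = x∈p─q⇒x∉q x∈p─q x∈q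

∣p∣≡∣p∩q∣+∣p─q∣ : ∀ (p q : Subset n) → ∣ p ∣ ≡ ∣ p ∩ q ∣ + ∣ p ─ q ∣
∣p∣≡∣p∩q∣+∣p─q∣ []            []            = refl
∣p∣≡∣p∩q∣+∣p─q∣ (inside  ∷ p) (inside  ∷ q) = cong suc (∣p∣≡∣p∩q∣+∣p─q∣ p q)
∣p∣≡∣p∩q∣+∣p─q∣ (inside  ∷ p) (outside ∷ q) =
  trans (cong suc (∣p∣≡∣p∩q∣+∣p─q∣ p q)) (≡.sym (+-suc _ _))
∣p∣≡∣p∩q∣+∣p─q∣ (outside ∷ p) (inside  ∷ q) = ∣p∣≡∣p∩q∣+∣p─q∣ p q
∣p∣≡∣p∩q∣+∣p─q∣ (outside ∷ p) (outside ∷ q) = ∣p∣≡∣p∩q∣+∣p─q∣ p q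

∣p∪q∣≡∣p∣+∣q─p∣ : ∀ (p q : Subset n) → ∣ p ∪ q ∣ ≡ ∣ p ∣ + ∣ q ─ p ∣
∣p∪q∣≡∣p∣+∣q─p∣ []            []            = refl
∣p∪q∣≡∣p∣+∣q─p∣ (inside  ∷ p) (_       ∷ q) = cong suc (∣p∪q∣≡∣p∣+∣q─p∣ p q)
∣p∪q∣≡∣p∣+∣q─p∣ (outside ∷ p) (inside  ∷ q) =
  trans (cong suc (∣p∪q∣≡∣p∣+∣q─p∣ p q)) (≡.sym (+-suc _ _))
∣p∪q∣≡∣p∣+∣q─p∣ (outside ∷ p) (outside ∷ q) = ∣p∪q∣≡∣p∣+∣q─p∣ p q

∣p∪q∣+∣p∩q∣≡∣p∣+∣q∣ : ∀ (p q : Subset n) → ∣ p ∪ q ∣ + ∣ p ∩ q ∣ ≡ ∣ p ∣ + ∣ q ∣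
∣p∪q∣+∣p∩q∣≡∣p∣+∣q∣ []            []            = refl
∣p∪q∣+∣p∩q∣≡∣p∣+∣q∣ (inside  ∷ p) (inside  ∷ q) =
  cong suc (trans (+-suc _ _) (trans (cong suc (∣p∪q∣+∣p∩q∣≡∣p∣+∣q∣ p q)) (≡.sym (+-suc _ _))))
∣p∪q∣+∣p∩q∣≡∣p∣+∣q∣ (inside  ∷ p) (outside ∷ q) = cong suc (∣p∪q∣+∣p∩q∣≡∣p∣+∣q∣ p q)
∣p∪q∣+∣p∩q∣≡∣p∣+∣q∣ (outside ∷ p) (inside  ∷ q) =
  trans (cong suc (∣p∪q∣+∣p∩q∣≡∣p∣+∣q∣ p q)) (≡.sym (+-suc _ _))
∣p∪q∣+∣p∩q∣≡∣p∣+∣q∣ (outside ∷ p) (outside ∷ q) = ∣p∪q∣+∣p∩q∣≡∣p∣+∣q∣ p q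

∣p∪q∣≤∣p∣+∣q∣ : ∀ (p q : Subset n) → ∣ p ∪ q ∣ ≤ ∣ p ∣ + ∣ q ∣
∣p∪q∣≤∣p∣+∣q∣ p q = subst (∣ p ∪ q ∣ ≤_) (∣p∪q∣+∣p∩q∣≡∣p∣+∣q∣ p q) (m≤m+n _ _)

Empty⇒∣p∣≡0 : Empty p → ∣ p ∣ ≡ 0
Empty⇒∣p∣≡0 {n} empty = trans (cong ∣_∣ (Empty-unique empty)) (∣⊥∣≡0 n)

disjoint⇒∣p∪q∣≡∣p∣+∣q∣ : (∀ {x} → x ∈ p → x ∉ q) → ∣ p ∪ q ∣ ≡ ∣ p ∣ + ∣ q ∣
disjoint⇒∣p∪q∣≡∣p∣+∣q∣ {p = p} {q} disjoint = begin
  ∣ p ∪ q ∣               ≡⟨ ≡.sym (+-identityʳ _) ⟩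
  ∣ p ∪ q ∣ + 0           ≡⟨ cong (∣ p ∪ q ∣ +_) (≡.sym (Empty⇒∣p∣≡0 p∩q-empty)) ⟩
  ∣ p ∪ q ∣ + ∣ p ∩ q ∣   ≡⟨ ∣p∪q∣+∣p∩q∣≡∣p∣+∣q∣ p q ⟩
  ∣ p ∣ + ∣ q ∣           ∎
  where
  open ≡-Reasoning
  p∩q-empty : Empty (p ∩ q)
  p∩q-empty (x , x∈p∩q) = let x∈p , x∈q = x∈p∩q⁻ p q x∈p∩q in disjoint x∈p x∈q

∣p∣>0⇒Nonempty : 0 < ∣ p ∣ → Nonempty p
∣p∣>0⇒Nonempty {p = p} ∣p∣>0 with nonempty? p
... | yes p≠∅ = p≠∅
... | no  p=∅ = contradiction (subst (0 <_) (Empty⇒∣p∣≡0 p=∅) ∣p∣>0) (λ ())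

p⊆q∪[p─q] : p ⊆ q ∪ (p ─ q)
p⊆q∪[p─q] {q = q} {x} x∈p with x ∈? q
... | yes x∈q = x∈p∪q⁺ (inj₁ x∈q)
... | no  x∉q = x∈p∪q⁺ (inj₂ (x∈p∧x∉q⇒x∈p─q x∈p x∉q))

∣p∣≡∣q∣⇒∣p─q∣≡∣q─p∣ : ∀ (p q : Subset n) → ∣ p ∣ ≡ ∣ q ∣ → ∣ p ─ q ∣ ≡ ∣ q ─ p ∣
∣p∣≡∣q∣⇒∣p─q∣≡∣q─p∣ p q ∣p∣≡∣q∣ = +-cancelˡ-≡ ∣ p ∩ q ∣ _ _ (begin
  ∣ p ∩ q ∣ + ∣ p ─ q ∣ ≡⟨ ≡.sym (∣p∣≡∣p∩q∣+∣p─q∣ p q) ⟩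
  ∣ p ∣                 ≡⟨ ∣p∣≡∣q∣ ⟩
  ∣ q ∣                 ≡⟨ ∣p∣≡∣p∩q∣+∣p─q∣ q p ⟩
  ∣ q ∩ p ∣ + ∣ q ─ p ∣ ≡⟨ cong (λ r → ∣ r ∣ + ∣ q ─ p ∣) (∩-comm q p) ⟩
  ∣ p ∩ q ∣ + ∣ q ─ p ∣ ∎)
  where open ≡-Reasoning

∣p∣≤1+∣p-x∣ : ∀ (p : Subset n) x → ∣ p ∣ ≤ suc ∣ p - x ∣
∣p∣≤1+∣p-x∣ (inside  ∷ p) zero    = s≤s (≤-reflexive (cong ∣_∣ (≡.sym (p─⊥≡p p))))
∣p∣≤1+∣p-x∣ (outside ∷ p) zero    = m≤n⇒m≤1+n (≤-reflexive (cong ∣_∣ (≡.sym (p─⊥≡p p))))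
∣p∣≤1+∣p-x∣ (inside  ∷ p) (suc x) = s≤s (∣p∣≤1+∣p-x∣ p x)
∣p∣≤1+∣p-x∣ (outside ∷ p) (suc x) = ∣p∣≤1+∣p-x∣ p x

x∈p⇒∣p∣≡1+∣p-x∣ : x ∈ p → ∣ p ∣ ≡ suc ∣ p - x ∣
x∈p⇒∣p∣≡1+∣p-x∣ {p = inside ∷ p} here = cong (suc ∘ ∣_∣) (≡.sym (p─⊥≡p p))
x∈p⇒∣p∣≡1+∣p-x∣ {p = inside  ∷ p} (there x∈p) = cong suc (x∈p⇒∣p∣≡1+∣p-x∣ x∈p)
x∈p⇒∣p∣≡1+∣p-x∣ {p = outside ∷ p} (there x∈p) = x∈p⇒∣p∣≡1+∣p-x∣ x∈p

injective⇒∣p∣≤∣q∣ : ∀ {p : Subset m} {q : Subset n} (f : Fin m → Fin n) →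
  (∀ {x} → x ∈ p → f x ∈ q) → (∀ {x y} → x ∈ p → y ∈ p → f x ≡ f y → x ≡ y) →
  ∣ p ∣ ≤ ∣ q ∣
injective⇒∣p∣≤∣q∣ {p = []} f _ _ = z≤n
injective⇒∣p∣≤∣q∣ {p = outside ∷ p} f into injective =
  injective⇒∣p∣≤∣q∣ (f ∘ suc) (into ∘ there)
    (λ x∈p y∈p e → suc-injective (injective (there x∈p) (there y∈p) e))
injective⇒∣p∣≤∣q∣ {p = inside ∷ p} {q} f into injective = begin
  suc ∣ p ∣          ≤⟨ s≤s (injective⇒∣p∣≤∣q∣ (f ∘ suc) into′ injective′) ⟩
  suc ∣ q - f zero ∣ ≡⟨ ≡.sym (x∈p⇒∣p∣≡1+∣p-x∣ (into here)) ⟩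
  ∣ q ∣              ∎
  where
  open ≤-Reasoning
  into′ : ∀ {x} → x ∈ p → f (suc x) ∈ q - f zero
  into′ x∈p = x∈p∧x≢y⇒x∈p-y (into (there x∈p)) (0≢1+n ∘ ≡.sym ∘ injective (there x∈p) here)
  injective′ : ∀ {x y} → x ∈ p → y ∈ p → f (suc x) ≡ f (suc y) → x ≡ y
  injective′ x∈p y∈p e = suc-injective (injective (there x∈p) (there y∈p) e)

p⊆q∧∣q∣≤∣p∣⇒q⊆p : p ⊆ q → ∣ q ∣ ≤ ∣ p ∣ → q ⊆ p
p⊆q∧∣q∣≤∣p∣⇒q⊆p {p = p} p⊆q ∣q∣≤∣p∣ {x} x∈q with x ∈? p
... | yes x∈p = x∈p
... | no  x∉p = contradiction (p⊂q⇒∣p∣<∣q∣ (p⊆q , x , x∈q , x∉p)) (≤⇒≯ ∣q∣≤∣p∣)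

module _ {ℓ} {P : Pred (Subset n) ℓ} (P? : Decidable P) where

  ∃-maximum : P p → ∃[ q ] P q × (∀ r → P r → ∣ r ∣ ≤ ∣ q ∣)
  ∃-maximum Pp = go Pp (<-wellFounded _)
    where
    go : ∀ {p} → P p → Acc _<_ (n ∸ ∣ p ∣) → ∃[ q ] P q × (∀ r → P r → ∣ r ∣ ≤ ∣ q ∣)
    go {p} Pp (acc rec) with anySubset? (λ r → P? r ×-dec ∣ p ∣ <? ∣ r ∣)
    ... | yes (r , Pr , ∣p∣<∣r∣) = go Pr (rec (∸-monoʳ-< ∣p∣<∣r∣ (∣p∣≤n r)))
    ... | no  ∄larger           = p , Pp , λ r Pr → ≮⇒≥ (λ ∣p∣<∣r∣ → ∄larger (r , Pr , ∣p∣<∣r∣))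

subsetOf : ∀ {ℓ} {P : Pred (Fin n) ℓ} → Decidable P → Subset n
subsetOf P? = tabulate (λ v → ⌊ P? v ⌋)

module _ {ℓ} {P : Pred (Fin n) ℓ} (P? : Decidable P) where

  ∈subsetOf⁺ : P x → x ∈ subsetOf P?
  ∈subsetOf⁺ {x} Px =
    lookup⇒[]= x _ (trans (lookup∘tabulate _ x) (Equivalence.to T-≡ (fromWitness Px)))

  ∈subsetOf⁻ : x ∈ subsetOf P? → P x
  ∈subsetOf⁻ {x} x∈ =
    toWitness (Equivalence.from T-≡ (trans (≡.sym (lookup∘tabulate _ x)) ([]=⇒lookup x∈)))

preimage : (Fin n → Fin n) → Subset n → Subset n
preimage f X = subsetOf (λ v → f v ∈? X)

∈preimage⁺ : ∀ (f : Fin n → Fin n) → f x ∈ X → x ∈ preimage f X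
∈preimage⁺ {X = X} f = ∈subsetOf⁺ (λ v → f v ∈? X)

∈preimage⁻ : ∀ (f : Fin n → Fin n) → x ∈ preimage f X → f x ∈ X
∈preimage⁻ {X = X} f = ∈subsetOf⁻ (λ v → f v ∈? X)

module _ (G : Graph n) where

  Adj-sym : Adj G u v → Adj G v u
  Adj-sym {u} {v} = subst T (Graph.sym G u v)

  ∈N⁺ : u ∈ X → Adj G u v → v ∈ N G X
  ∈N⁺ {X = X} u∈X uv = ∈subsetOf⁺ (λ v → any? (λ u → (u ∈? X) ×-dec T? (adj G u v))) (_ , u∈X , uv)

  ∈N⁻ : v ∈ N G X → ∃[ u ] u ∈ X × Adj G u v
  ∈N⁻ {X = X} = ∈subsetOf⁻ (λ v → any? (λ u → (u ∈? X) ×-dec T? (adj G u v)))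

  N-mono : X ⊆ Y → N G X ⊆ N G Y
  N-mono X⊆Y v∈NX = let _ , u∈X , uv = ∈N⁻ v∈NX in ∈N⁺ (X⊆Y u∈X) uv

  N-∪ : N G (X ∪ Y) ⊆ N G X ∪ N G Y
  N-∪ {X = X} {Y} v∈N = let _ , u∈X∪Y , uv = ∈N⁻ v∈N in
    x∈p∪q⁺ (Sum.map (λ u∈X → ∈N⁺ u∈X uv) (λ u∈Y → ∈N⁺ u∈Y uv) (x∈p∪q⁻ X Y u∈X∪Y))

  N-∩ : N G (X ∩ Y) ⊆ N G X ∩ N G Y
  N-∩ {X = X} {Y} v∈N = x∈p∩q⁺ (N-mono (p∩q⊆p X Y) v∈N , N-mono (p∩q⊆q X Y) v∈N)

  independent? : Decidable (Independent G)
  independent? X = all? λ u → all? λ v → (u ∈? X) →-dec (v ∈? X) →-dec ¬? (T? (adj G u v))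

  independent⇒∉N : Independent G X → v ∈ X → v ∉ N G X
  independent⇒∉N indX v∈X v∈NX = let u , u∈X , uv = ∈N⁻ v∈NX in indX u _ u∈X v∈X uv

  ─N-independent : Independent G (X ─ N G X)
  ─N-independent {X = X} u v u∈X′ v∈X′ uv =
    x∈p─q⇒x∉q v∈X′ (∈N⁺ (p─q⊆p X (N G X) u∈X′) uv)

  independent-⊆ : X ⊆ Y → Independent G Y → Independent G X
  independent-⊆ X⊆Y indY u v u∈X v∈X = indY u v (X⊆Y u∈X) (X⊆Y v∈X)

  N[X─NY]⊆NX─Y : N G (X ─ N G Y) ⊆ N G X ─ Y
  N[X─NY]⊆NX─Y {X = X} v∈N = let _ , u∈X─NY , uv = ∈N⁻ v∈N in
    x∈p∧x∉q⇒x∈p─q (∈N⁺ (p─q⊆p X _ u∈X─NY) uv) (λ v∈Y → x∈p─q⇒x∉q u∈X─NY (∈N⁺ v∈Y (Adj-sym uv)))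

  independent-∪ : Independent G X → Independent G Y →
    (∀ {u v} → u ∈ X → v ∈ Y → ¬ Adj G u v) → Independent G (X ∪ Y)
  independent-∪ {X = X} {Y} indX indY cross u v u∈ v∈ uv with x∈p∪q⁻ X Y u∈ | x∈p∪q⁻ X Y v∈
  ... | inj₁ u∈X | inj₁ v∈X = indX u v u∈X v∈X uv
  ... | inj₁ u∈X | inj₂ v∈Y = cross u∈X v∈Y uv
  ... | inj₂ u∈Y | inj₁ v∈X = cross v∈X u∈Y (Adj-sym uv)
  ... | inj₂ u∈Y | inj₂ v∈Y = indY u v u∈Y v∈Y uv

  -- Critical independent sets

  -- X ≼ Y says |X| - |N X| ≤ |Y| - |N Y|, rearranged to stay in ℕ; thus Critical I says that I is
  -- independent and J ≼ I for every independent J.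
  infix 4 _≼_
  _≼_ : Subset n → Subset n → Set
  X ≼ Y = ∣ X ∣ + ∣ N G Y ∣ ≤ ∣ Y ∣ + ∣ N G X ∣

  ≼-refl : X ≼ X
  ≼-refl = ≤-refl

  ≼-trans : X ≼ Y → Y ≼ Z → X ≼ Z
  ≼-trans {X = X} {Y} {Z} =
    diff-trans {∣ X ∣} {∣ N G X ∣} {∣ Y ∣} {∣ N G Y ∣} {∣ Z ∣} {∣ N G Z ∣}

  ≼-─N : X ≼ X ─ N G X
  ≼-─N {X = X} = begin
    ∣ X ∣ + ∣ N G X′ ∣                         ≡⟨ cong (_+ ∣ N G X′ ∣) (∣p∣≡∣p∩q∣+∣p─q∣ X (N G X)) ⟩
    (∣ X ∩ N G X ∣ + ∣ X′ ∣) + ∣ N G X′ ∣      ≤⟨ +-monoʳ-≤ _ (p⊆q⇒∣p∣≤∣q∣ (N[X─NY]⊆NX─Y {X = X} {Y = X})) ⟩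
    (∣ X ∩ N G X ∣ + ∣ X′ ∣) + ∣ N G X ─ X ∣   ≡⟨ xy∙z≈y∙xz ∣ X ∩ N G X ∣ _ _ ⟩
    ∣ X′ ∣ + (∣ X ∩ N G X ∣ + ∣ N G X ─ X ∣)   ≡⟨ cong (λ A → ∣ X′ ∣ + (∣ A ∣ + ∣ N G X ─ X ∣)) (∩-comm X (N G X)) ⟩
    ∣ X′ ∣ + (∣ N G X ∩ X ∣ + ∣ N G X ─ X ∣)   ≡⟨ cong (∣ X′ ∣ +_) (≡.sym (∣p∣≡∣p∩q∣+∣p─q∣ (N G X) X)) ⟩
    ∣ X′ ∣ + ∣ N G X ∣                         ∎
    where
    open ≤-Reasoning
    X′ = X ─ N G X

  critical⇒≼ : Critical G I → X ≼ I
  critical⇒≼ {X = X} (_ , maximal) = ≼-trans ≼-─N (maximal (X ─ N G X) ─N-independent)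

  N-submodular : ∣ N G (X ∪ Y) ∣ + ∣ N G (X ∩ Y) ∣ ≤ ∣ N G X ∣ + ∣ N G Y ∣
  N-submodular {X = X} {Y} = begin
    ∣ N G (X ∪ Y) ∣ + ∣ N G (X ∩ Y) ∣     ≤⟨ +-mono-≤ (p⊆q⇒∣p∣≤∣q∣ N-∪) (p⊆q⇒∣p∣≤∣q∣ N-∩) ⟩
    ∣ N G X ∪ N G Y ∣ + ∣ N G X ∩ N G Y ∣ ≡⟨ ∣p∪q∣+∣p∩q∣≡∣p∣+∣q∣ (N G X) (N G Y) ⟩
    ∣ N G X ∣ + ∣ N G Y ∣                  ∎
    where open ≤-Reasoning

  ≼-∪ : Critical G I → I ≼ X → I ≼ Y → I ≼ X ∪ Y
  ≼-∪ {I = I} {X = X} {Y = Y} critI =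
    diff-supermodular {∣ I ∣} {∣ X ∣} {∣ Y ∣} {∣ X ∪ Y ∣} {∣ X ∩ Y ∣}
                      {∣ N G I ∣} {∣ N G X ∣} {∣ N G Y ∣} {∣ N G (X ∪ Y) ∣} {∣ N G (X ∩ Y) ∣}
      (∣p∪q∣+∣p∩q∣≡∣p∣+∣q∣ X Y) N-submodular (critical⇒≼ critI)

  ≼-∪-critical : Critical G I → Critical G J → I ≼ I ∪ J
  ≼-∪-critical critI critJ = ≼-∪ critI ≼-refl (proj₂ critJ _ (proj₁ critI))

  critical-upward : Critical G I → Independent G Y → I ≼ Y → Critical G Y
  critical-upward critI indY I≼Y = indY , λ J indJ → ≼-trans (proj₂ critI J indJ) I≼Y

  maxCritical-⊆⇒⊇ : MaxCritical G I → Critical G Y → I ⊆ Y → Y ⊆ I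
  maxCritical-⊆⇒⊇ (_ , maximum) critY I⊆Y = p⊆q∧∣q∣≤∣p∣⇒q⊆p I⊆Y (maximum _ critY)

  critical⊆L : MaxCritical G I → Critical G J → v ∈ J → InL G I v
  critical⊆L {I = I} {J = J} {v = v} maxI@(critI , _) critJ v∈J with v ∈? N G I
  ... | yes v∈NI = inj₂ v∈NI
  ... | no  v∉NI = inj₁ (I∪X′⊆I (q⊆p∪q I X′ v∈X′))
    where
    X′ = (I ∪ J) ─ N G (I ∪ J)
    v∈X′ : v ∈ X′
    v∈X′ = x∈p∧x∉q⇒x∈p─q (q⊆p∪q I J v∈J)
      ([ v∉NI , independent⇒∉N (proj₁ critJ) v∈J ]′ ∘ x∈p∪q⁻ _ _ ∘ N-∪)
    independent-I∪X′ : Independent G (I ∪ X′)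
    independent-I∪X′ = independent-∪ (proj₁ critI) ─N-independent
      (λ u∈I w∈X′ uw → x∈p─q⇒x∉q w∈X′ (∈N⁺ (p⊆p∪q J u∈I) uw))
    I∪X′⊆I : I ∪ X′ ⊆ I
    I∪X′⊆I = maxCritical-⊆⇒⊇ maxI
      (critical-upward critI independent-I∪X′ (≼-∪ critI ≼-refl (≼-trans (≼-∪-critical critI critJ) ≼-─N)))
      (p⊆p∪q X′)

  maxCritical-∣∣≡ : MaxCritical G I → MaxCritical G J → ∣ I ∣ ≡ ∣ J ∣
  maxCritical-∣∣≡ (critI , maxI) (critJ , maxJ) = ≤-antisym (maxJ _ critI) (maxI _ critJ)

  N-maxCritical⊆L : MaxCritical G I → MaxCritical G J → v ∈ N G J → InL G I v
  N-maxCritical⊆L {I = I} {J = J} {v = v} maxI@(critI , _) maxJ@(critJ , _) v∈NJ with v ∈? N G I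
  ... | yes v∈NI = inj₂ v∈NI
  ... | no  v∉NI = inj₁ (p─q⊆p I J (NJ─NI⊆I─J (x∈p∧x∉q⇒x∈p─q v∈NJ v∉NI)))
    where
    I─J⊆NJ─NI : I ─ J ⊆ N G J ─ N G I
    I─J⊆NJ─NI u∈I─J with critical⊆L maxJ critI (p─q⊆p I J u∈I─J)
    ... | inj₁ u∈J  = contradiction u∈J (x∈p─q⇒x∉q u∈I─J)
    ... | inj₂ u∈NJ = x∈p∧x∉q⇒x∈p─q u∈NJ (independent⇒∉N (proj₁ critI) (p─q⊆p I J u∈I─J))
    NI∪NJ⊆N[I∪J] : N G I ∪ N G J ⊆ N G (I ∪ J)
    NI∪NJ⊆N[I∪J] = [ N-mono (p⊆p∪q J) , N-mono (q⊆p∪q I J) ]′ ∘ x∈p∪q⁻ _ _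
    ∣J─I∣≡∣I─J∣ : ∣ J ─ I ∣ ≡ ∣ I ─ J ∣
    ∣J─I∣≡∣I─J∣ = ∣p∣≡∣q∣⇒∣p─q∣≡∣q─p∣ J I (≡.sym (maxCritical-∣∣≡ maxI maxJ))
    ∣NJ─NI∣≤∣I─J∣ : ∣ N G J ─ N G I ∣ ≤ ∣ I ─ J ∣
    ∣NJ─NI∣≤∣I─J∣ = +-cancelˡ-≤ (∣ I ∣ + ∣ N G I ∣) _ _ (begin
      (∣ I ∣ + ∣ N G I ∣) + ∣ N G J ─ N G I ∣ ≡⟨ +-assoc ∣ I ∣ _ _ ⟩
      ∣ I ∣ + (∣ N G I ∣ + ∣ N G J ─ N G I ∣) ≡⟨ cong (∣ I ∣ +_) (≡.sym (∣p∪q∣≡∣p∣+∣q─p∣ (N G I) (N G J))) ⟩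
      ∣ I ∣ + ∣ N G I ∪ N G J ∣                ≤⟨ +-monoʳ-≤ ∣ I ∣ (p⊆q⇒∣p∣≤∣q∣ NI∪NJ⊆N[I∪J]) ⟩
      ∣ I ∣ + ∣ N G (I ∪ J) ∣                  ≤⟨ ≼-∪-critical critI critJ ⟩
      ∣ I ∪ J ∣ + ∣ N G I ∣                    ≡⟨ cong (_+ ∣ N G I ∣) (∣p∪q∣≡∣p∣+∣q─p∣ I J) ⟩
      (∣ I ∣ + ∣ J ─ I ∣) + ∣ N G I ∣          ≡⟨ xy∙z≈xz∙y ∣ I ∣ _ _ ⟩
      (∣ I ∣ + ∣ N G I ∣) + ∣ J ─ I ∣          ≡⟨ cong (_ +_) ∣J─I∣≡∣I─J∣ ⟩
      (∣ I ∣ + ∣ N G I ∣) + ∣ I ─ J ∣          ∎)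
      where open ≤-Reasoning
    NJ─NI⊆I─J : N G J ─ N G I ⊆ I ─ J
    NJ─NI⊆I─J = p⊆q∧∣q∣≤∣p∣⇒q⊆p I─J⊆NJ─NI ∣NJ─NI∣≤∣I─J∣

  -- Hall's theorem

  HallCondition : Subset n → Subset n → Set
  HallCondition P Q = ∀ b → b ⊆ P → ∣ b ∣ ≤ ∣ N G b ∩ Q ∣

  critical⇒hall : Critical G I → HallCondition (N G I) I
  critical⇒hall {I = I} (indI , maximal) b b⊆NI = +-cancelˡ-≤ (∣ I′ ∣ + ∣ N G I ─ b ∣) _ _ (begin
    (∣ I′ ∣ + ∣ N G I ─ b ∣) + ∣ b ∣          ≡⟨ xy∙z≈x∙zy ∣ I′ ∣ _ _ ⟩
    ∣ I′ ∣ + (∣ b ∣ + ∣ N G I ─ b ∣)          ≤⟨ +-monoʳ-≤ ∣ I′ ∣ (+-monoˡ-≤ _ (p⊆q⇒∣p∣≤∣q∣ b⊆NI∩b)) ⟩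
    ∣ I′ ∣ + (∣ N G I ∩ b ∣ + ∣ N G I ─ b ∣)  ≡⟨ cong (∣ I′ ∣ +_) (≡.sym (∣p∣≡∣p∩q∣+∣p─q∣ (N G I) b)) ⟩
    ∣ I′ ∣ + ∣ N G I ∣                         ≤⟨ maximal I′ (independent-⊆ (p─q⊆p I _) indI) ⟩
    ∣ I ∣ + ∣ N G I′ ∣                         ≤⟨ +-monoʳ-≤ ∣ I ∣ (p⊆q⇒∣p∣≤∣q∣ (N[X─NY]⊆NX─Y {X = I} {Y = b})) ⟩
    ∣ I ∣ + ∣ N G I ─ b ∣                      ≡⟨ cong (_+ ∣ N G I ─ b ∣) (∣p∣≡∣p∩q∣+∣p─q∣ I (N G b)) ⟩
    (∣ I ∩ N G b ∣ + ∣ I′ ∣) + ∣ N G I ─ b ∣   ≡⟨ cong (λ A → (∣ A ∣ + ∣ I′ ∣) + ∣ N G I ─ b ∣) (∩-comm I (N G b)) ⟩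
    (∣ N G b ∩ I ∣ + ∣ I′ ∣) + ∣ N G I ─ b ∣   ≡⟨ xy∙z≈yz∙x ∣ N G b ∩ I ∣ _ _ ⟩
    (∣ I′ ∣ + ∣ N G I ─ b ∣) + ∣ N G b ∩ I ∣   ∎)
    where
    open ≤-Reasoning
    I′ = I ─ N G b
    b⊆NI∩b : b ⊆ N G I ∩ b
    b⊆NI∩b v∈b = x∈p∩q⁺ (b⊆NI v∈b , v∈b)

  record EdgeInjection (P Q : Subset n) : Set where
    field
      to           : Fin n → Fin n
      to-∈         : ∀ {p} → p ∈ P → to p ∈ Q
      to-adj       : ∀ {p} → p ∈ P → Adj G p (to p)
      to-injective : ∀ {p p′} → p ∈ P → p′ ∈ P → to p ≡ to p′ → p ≡ p′

  open EdgeInjection public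

  EdgeInjection-mono : ∀ {P′ Q′} → P′ ⊆ P → Q ⊆ Q′ → EdgeInjection P Q → EdgeInjection P′ Q′
  EdgeInjection-mono P′⊆P Q⊆Q′ f = record
    { to           = to f
    ; to-∈         = Q⊆Q′ ∘ to-∈ f ∘ P′⊆P
    ; to-adj       = to-adj f ∘ P′⊆P
    ; to-injective = λ p∈P′ p′∈P′ → to-injective f (P′⊆P p∈P′) (P′⊆P p′∈P′)
    }

  EdgeInjection-∅ : Empty P → EdgeInjection P Q
  EdgeInjection-∅ P=∅ = record
    { to           = id
    ; to-∈         = λ p∈P → contradiction (_ , p∈P) P=∅
    ; to-adj       = λ p∈P → contradiction (_ , p∈P) P=∅
    ; to-injective = λ p∈P _ _ → contradiction (_ , p∈P) P=∅
    }

  EdgeInjection-edge : Adj G u v → EdgeInjection ⁅ u ⁆ ⁅ v ⁆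
  EdgeInjection-edge {u = u} {v} uv = record
    { to           = λ _ → v
    ; to-∈         = λ _ → x∈⁅x⁆ v
    ; to-adj       = λ p∈⁅u⁆ → subst (λ w → Adj G w v) (≡.sym (x∈⁅y⁆⇒x≡y u p∈⁅u⁆)) uv
    ; to-injective = λ p∈⁅u⁆ p′∈⁅u⁆ _ → trans (x∈⁅y⁆⇒x≡y u p∈⁅u⁆) (≡.sym (x∈⁅y⁆⇒x≡y u p′∈⁅u⁆))
    }

  module _ {P₁ P₂ Q₁ Q₂ : Subset n} (f : EdgeInjection P₁ Q₁) (g : EdgeInjection P₂ Q₂)
           (Q₁∩Q₂=∅ : ∀ {v} → v ∈ Q₁ → v ∉ Q₂) where

    private
      h : Fin n → Fin n
      h p with p ∈? P₁
      ... | yes _ = to f p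
      ... | no  _ = to g p

      ∈P₂ : u ∈ P₁ ∪ P₂ → u ∉ P₁ → u ∈ P₂
      ∈P₂ p∈ p∉P₁ = [ (λ p∈P₁ → contradiction p∈P₁ p∉P₁) , id ]′ (x∈p∪q⁻ P₁ P₂ p∈)

      h-∈ : u ∈ P₁ ∪ P₂ → h u ∈ Q₁ ∪ Q₂
      h-∈ {u = p} p∈ with p ∈? P₁
      ... | yes p∈P₁ = x∈p∪q⁺ (inj₁ (to-∈ f p∈P₁))
      ... | no  p∉P₁ = x∈p∪q⁺ (inj₂ (to-∈ g (∈P₂ p∈ p∉P₁)))

      h-adj : u ∈ P₁ ∪ P₂ → Adj G u (h u)
      h-adj {u = p} p∈ with p ∈? P₁
      ... | yes p∈P₁ = to-adj f p∈P₁
      ... | no  p∉P₁ = to-adj g (∈P₂ p∈ p∉P₁)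

      h-injective : u ∈ P₁ ∪ P₂ → v ∈ P₁ ∪ P₂ → h u ≡ h v → u ≡ v
      h-injective {u = p} {v = q} p∈ q∈ e with p ∈? P₁ | q ∈? P₁
      ... | yes p∈P₁ | yes q∈P₁ = to-injective f p∈P₁ q∈P₁ e
      ... | yes p∈P₁ | no  q∉P₁ =
        contradiction (to-∈ g (∈P₂ q∈ q∉P₁)) (Q₁∩Q₂=∅ (subst (_∈ Q₁) e (to-∈ f p∈P₁)))
      ... | no  p∉P₁ | yes q∈P₁ =
        contradiction (to-∈ g (∈P₂ p∈ p∉P₁)) (Q₁∩Q₂=∅ (subst (_∈ Q₁) (≡.sym e) (to-∈ f q∈P₁)))
      ... | no  p∉P₁ | no  q∉P₁ = to-injective g (∈P₂ p∈ p∉P₁) (∈P₂ q∈ q∉P₁) e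

    EdgeInjection-∪ : EdgeInjection (P₁ ∪ P₂) (Q₁ ∪ Q₂)
    EdgeInjection-∪ = record { to = h ; to-∈ = h-∈ ; to-adj = h-adj ; to-injective = h-injective }

  Tight : Subset n → Subset n → Subset n → Set
  Tight P Q a = a ⊆ P × Nonempty a × ∣ a ∣ < ∣ P ∣ × ∣ N G a ∩ Q ∣ ≤ ∣ a ∣

  tight? : ∀ P Q → Decidable (Tight P Q)
  tight? P Q a = a ⊆? P ×-dec nonempty? a ×-dec ∣ a ∣ <? ∣ P ∣ ×-dec ∣ N G a ∩ Q ∣ ≤? ∣ a ∣

  hall-⊆ : HallCondition P Q → A ⊆ P → HallCondition A (N G A ∩ Q)
  hall-⊆ {Q = Q} {A = A} hallPQ A⊆P b b⊆A = begin
    ∣ b ∣                  ≤⟨ hallPQ b (A⊆P ∘ b⊆A) ⟩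
    ∣ N G b ∩ Q ∣          ≤⟨ p⊆q⇒∣p∣≤∣q∣ Nb∩Q⊆Nb∩NA∩Q ⟩
    ∣ N G b ∩ (N G A ∩ Q) ∣ ∎
    where
    open ≤-Reasoning
    Nb∩Q⊆Nb∩NA∩Q : N G b ∩ Q ⊆ N G b ∩ (N G A ∩ Q)
    Nb∩Q⊆Nb∩NA∩Q v∈ = let v∈Nb , v∈Q = x∈p∩q⁻ _ _ v∈ in
      x∈p∩q⁺ (v∈Nb , x∈p∩q⁺ (N-mono b⊆A v∈Nb , v∈Q))

  hall-─tight : HallCondition P Q → A ⊆ P → ∣ N G A ∩ Q ∣ ≤ ∣ A ∣ →
    HallCondition (P ─ A) (Q ─ N G A)
  hall-─tight {P = P} {Q = Q} {A = A} hallPQ A⊆P tight b b⊆P─A = +-cancelˡ-≤ ∣ A ∣ _ _ (begin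
    ∣ A ∣ + ∣ b ∣                            ≡⟨ ≡.sym (disjoint⇒∣p∪q∣≡∣p∣+∣q∣ A∩b=∅) ⟩
    ∣ A ∪ b ∣                                ≤⟨ hallPQ (A ∪ b) A∪b⊆P ⟩
    ∣ N G (A ∪ b) ∩ Q ∣                      ≤⟨ p⊆q⇒∣p∣≤∣q∣ split ⟩
    ∣ (N G A ∩ Q) ∪ (N G b ∩ (Q ─ N G A)) ∣  ≤⟨ ∣p∪q∣≤∣p∣+∣q∣ (N G A ∩ Q) _ ⟩
    ∣ N G A ∩ Q ∣ + ∣ N G b ∩ (Q ─ N G A) ∣  ≤⟨ +-monoˡ-≤ _ tight ⟩
    ∣ A ∣ + ∣ N G b ∩ (Q ─ N G A) ∣          ∎)
    where
    open ≤-Reasoning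
    A∩b=∅ : ∀ {v} → v ∈ A → v ∉ b
    A∩b=∅ v∈A v∈b = x∈p─q⇒x∉q (b⊆P─A v∈b) v∈A
    A∪b⊆P : A ∪ b ⊆ P
    A∪b⊆P = [ A⊆P , p─q⊆p P A ∘ b⊆P─A ]′ ∘ x∈p∪q⁻ A b
    split : N G (A ∪ b) ∩ Q ⊆ (N G A ∩ Q) ∪ (N G b ∩ (Q ─ N G A))
    split {v} v∈ with x∈p∩q⁻ _ _ v∈ | v ∈? N G A
    ... | _ , v∈Q | yes v∈NA = x∈p∪q⁺ (inj₁ (x∈p∩q⁺ (v∈NA , v∈Q)))
    ... | v∈N[A∪b] , v∈Q | no v∉NA = x∈p∪q⁺ (inj₂ (x∈p∩q⁺ (v∈Nb , x∈p∧x∉q⇒x∈p─q v∈Q v∉NA)))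
      where
      v∈Nb = [ (λ v∈NA → contradiction v∈NA v∉NA) , id ]′ (x∈p∪q⁻ _ _ (N-∪ v∈N[A∪b]))

  hall-─edge : HallCondition P Q →
    (∀ b → b ⊆ P → Nonempty b → ∣ b ∣ < ∣ P ∣ → ∣ b ∣ < ∣ N G b ∩ Q ∣) →
    u ∈ P → HallCondition (P - u) (Q - v)
  hall-─edge {P = P} {Q = Q} {u = u} {v = v} hallPQ surplus u∈P b b⊆P-u with nonempty? b
  ... | no  b=∅ = subst (_≤ ∣ N G b ∩ (Q - v) ∣) (≡.sym (Empty⇒∣p∣≡0 b=∅)) z≤n
  ... | yes b≠∅ = ≤-pred (begin
    suc ∣ b ∣                ≤⟨ surplus b (p─q⊆p P _ ∘ b⊆P-u) b≠∅ ∣b∣<∣P∣ ⟩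
    ∣ N G b ∩ Q ∣            ≤⟨ ∣p∣≤1+∣p-x∣ (N G b ∩ Q) v ⟩
    suc ∣ N G b ∩ Q - v ∣    ≤⟨ s≤s (p⊆q⇒∣p∣≤∣q∣ Nb∩Q-v⊆Nb∩[Q-v]) ⟩
    suc ∣ N G b ∩ (Q - v) ∣  ∎)
    where
    open ≤-Reasoning
    ∣b∣<∣P∣ : ∣ b ∣ < ∣ P ∣
    ∣b∣<∣P∣ = ≤-<-trans (p⊆q⇒∣p∣≤∣q∣ b⊆P-u) (x∈p⇒∣p-x∣<∣p∣ u∈P)
    Nb∩Q-v⊆Nb∩[Q-v] : N G b ∩ Q - v ⊆ N G b ∩ (Q - v)
    Nb∩Q-v⊆Nb∩[Q-v] w∈ = let w∈Nb , w∈Q = x∈p∩q⁻ (N G b) Q (p─q⊆p (N G b ∩ Q) ⁅ v ⁆ w∈) in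
      x∈p∩q⁺ (w∈Nb , x∈p∧x∉q⇒x∈p─q w∈Q (x∈p─q⇒x∉q w∈))

  hall-neighbour : HallCondition P Q → u ∈ P → ∃[ v ] v ∈ Q × Adj G u v
  hall-neighbour {P = P} {Q = Q} {u = u} hallPQ u∈P =
    let v , v∈N⁅u⁆∩Q = ∣p∣>0⇒Nonempty ∣N⁅u⁆∩Q∣>0
        v∈N⁅u⁆ , v∈Q = x∈p∩q⁻ (N G ⁅ u ⁆) Q v∈N⁅u⁆∩Q
        w , w∈⁅u⁆ , wv = ∈N⁻ v∈N⁅u⁆
    in v , v∈Q , subst (λ w → Adj G w v) (x∈⁅y⁆⇒x≡y u w∈⁅u⁆) wv
    where
    ∣N⁅u⁆∩Q∣>0 : 0 < ∣ N G ⁅ u ⁆ ∩ Q ∣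
    ∣N⁅u⁆∩Q∣>0 = subst (_≤ ∣ N G ⁅ u ⁆ ∩ Q ∣) (∣⁅x⁆∣≡1 u)
      (hallPQ ⁅ u ⁆ (λ w∈⁅u⁆ → subst (_∈ P) (≡.sym (x∈⁅y⁆⇒x≡y u w∈⁅u⁆)) u∈P))

  hall : HallCondition P Q → EdgeInjection P Q
  hall {P = P} = go P (<-wellFounded ∣ P ∣)
    where
    -- Induction on |P|: split along a tight proper subset if there is one; otherwise every proper
    -- subset has surplus, so matching any u ∈ P to any neighbour in Q preserves Hall's condition.
    go : ∀ P {Q} → Acc _<_ ∣ P ∣ → HallCondition P Q → EdgeInjection P Q
    go P {Q} (acc rec) hallPQ with anySubset? (tight? P Q)
    ... | yes (A , A⊆P , (z , z∈A) , ∣A∣<∣P∣ , tight) =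
      EdgeInjection-mono p⊆q∪[p─q] Q′⊆Q (EdgeInjection-∪ on-A off-A disjoint)
      where
      on-A = go A (rec ∣A∣<∣P∣) (hall-⊆ hallPQ A⊆P)
      off-A = go (P ─ A) (rec (p∩q≢∅⇒∣p─q∣<∣p∣ P A (z , x∈p∩q⁺ (A⊆P z∈A , z∈A))))
                  (hall-─tight hallPQ A⊆P tight)
      disjoint : ∀ {w} → w ∈ N G A ∩ Q → w ∉ Q ─ N G A
      disjoint w∈₁ w∈₂ = x∈p─q⇒x∉q w∈₂ (p∩q⊆p _ _ w∈₁)
      Q′⊆Q : (N G A ∩ Q) ∪ (Q ─ N G A) ⊆ Q
      Q′⊆Q = [ p∩q⊆q _ _ , p─q⊆p _ _ ]′ ∘ x∈p∪q⁻ _ _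
    ... | no ∄tight with nonempty? P
    ...   | no  P=∅ = EdgeInjection-∅ P=∅
    ...   | yes (u , u∈P) with hall-neighbour hallPQ u∈P
    ...     | v , v∈Q , uv =
      EdgeInjection-mono p⊆q∪[p─q] Q′⊆Q (EdgeInjection-∪ (EdgeInjection-edge uv) rest disjoint)
      where
      surplus : ∀ b → b ⊆ P → Nonempty b → ∣ b ∣ < ∣ P ∣ → ∣ b ∣ < ∣ N G b ∩ Q ∣
      surplus b b⊆P b≠∅ ∣b∣<∣P∣ = ≰⇒> (λ tight → ∄tight (b , b⊆P , b≠∅ , ∣b∣<∣P∣ , tight))
      rest = go (P - u) (rec (x∈p⇒∣p-x∣<∣p∣ u∈P)) (hall-─edge hallPQ surplus u∈P)
      disjoint : ∀ {w} → w ∈ ⁅ v ⁆ → w ∉ Q - v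
      disjoint w∈⁅v⁆ w∈Q-v = x∈p─q⇒x∉q w∈Q-v w∈⁅v⁆
      Q′⊆Q : ⁅ v ⁆ ∪ (Q - v) ⊆ Q
      Q′⊆Q = [ (λ w∈⁅v⁆ → subst (_∈ Q) (≡.sym (x∈⁅y⁆⇒x≡y v w∈⁅v⁆)) v∈Q) , p─q⊆p _ _ ]′ ∘ x∈p∪q⁻ _ _

  -- Maximum independent sets and the corona

  maximumIndependent-exists : ∃[ S ] MaximumIndependent G S
  maximumIndependent-exists = ∃-maximum independent? {p = ⊥} (λ _ _ u∈⊥ → contradiction u∈⊥ ∉⊥)

  critical-extends : Critical G J → MaximumIndependent G X → MaximumIndependent G (J ∪ (X ─ N G J))
  critical-extends {J = J} {X = S} critJ (indS , maxS) =
    independent-J∪S′ , λ K indK → ≤-trans (maxS K indK) ∣S∣≤∣J∪S′∣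
    where
    open ≤-Reasoning
    independent-J∪S′ : Independent G (J ∪ (S ─ N G J))
    independent-J∪S′ = independent-∪ (proj₁ critJ) (independent-⊆ (p─q⊆p S _) indS)
      (λ u∈J v∈S─NJ uv → x∈p─q⇒x∉q v∈S─NJ (∈N⁺ u∈J uv))
    N[S∩NJ]∩J⊆J─S : N G (S ∩ N G J) ∩ J ⊆ J ─ S
    N[S∩NJ]∩J⊆J─S v∈ =
      let v∈N , v∈J = x∈p∩q⁻ (N G (S ∩ N G J)) J v∈
          w , w∈S∩NJ , wv = ∈N⁻ v∈N
      in x∈p∧x∉q⇒x∈p─q v∈J (λ v∈S → indS w _ (p∩q⊆p S _ w∈S∩NJ) v∈S wv)
    J─S∩S′=∅ : ∀ {v} → v ∈ J ─ S → v ∉ S ─ N G J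
    J─S∩S′=∅ v∈J─S = x∈p─q⇒x∉q v∈J─S ∘ p─q⊆p S (N G J)
    J─S∪S′⊆J∪S′ : (J ─ S) ∪ (S ─ N G J) ⊆ J ∪ (S ─ N G J)
    J─S∪S′⊆J∪S′ = [ p⊆p∪q _ ∘ p─q⊆p J S , q⊆p∪q J _ ]′ ∘ x∈p∪q⁻ _ _
    ∣S∣≤∣J∪S′∣ : ∣ S ∣ ≤ ∣ J ∪ (S ─ N G J) ∣
    ∣S∣≤∣J∪S′∣ = begin
      ∣ S ∣                                   ≡⟨ ∣p∣≡∣p∩q∣+∣p─q∣ S (N G J) ⟩
      ∣ S ∩ N G J ∣ + ∣ S ─ N G J ∣           ≤⟨ +-monoˡ-≤ _ (critical⇒hall critJ _ (p∩q⊆q S _)) ⟩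
      ∣ N G (S ∩ N G J) ∩ J ∣ + ∣ S ─ N G J ∣ ≤⟨ +-monoˡ-≤ _ (p⊆q⇒∣p∣≤∣q∣ N[S∩NJ]∩J⊆J─S) ⟩
      ∣ J ─ S ∣ + ∣ S ─ N G J ∣               ≡⟨ ≡.sym (disjoint⇒∣p∪q∣≡∣p∣+∣q∣ J─S∩S′=∅) ⟩
      ∣ (J ─ S) ∪ (S ─ N G J) ∣               ≤⟨ p⊆q⇒∣p∣≤∣q∣ J─S∪S′⊆J∪S′ ⟩
      ∣ J ∪ (S ─ N G J) ∣                     ∎

  critical⊆corona : Critical G J → v ∈ J → InCorona G v
  critical⊆corona {J = J} critJ v∈J =
    let S , maxS = maximumIndependent-exists
    in J ∪ (S ─ N G J) , critical-extends critJ maxS , p⊆p∪q _ v∈J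

  -- Matchings

  ∈Saturated⁺ : ∀ {μ} → μ v ≢ v → v ∈ Saturated G μ
  ∈Saturated⁺ {μ = μ} = ∈subsetOf⁺ (λ v → ¬? (μ v ≟ v))

  ∈Saturated⁻ : ∀ {μ} → v ∈ Saturated G μ → μ v ≢ v
  ∈Saturated⁻ {μ = μ} = ∈subsetOf⁻ (λ v → ¬? (μ v ≟ v))

  module _ {P Q : Subset n} (f : EdgeInjection P Q) (P∩Q=∅ : ∀ {v} → v ∈ P → v ∉ Q) where

    private
      HasPreimage : Fin n → Set
      HasPreimage v = ∃[ u ] u ∈ P × to f u ≡ v

      hasPreimage? : ∀ v → Dec (HasPreimage v)
      hasPreimage? v = any? (λ u → u ∈? P ×-dec to f u ≟ v)

    -- The partner map of the matching {p, to f p} (p ∈ P).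
    matching : Fin n → Fin n
    matching v with v ∈? P | hasPreimage? v
    ... | yes _ | _               = to f v
    ... | no  _ | yes (u , _ , _) = u
    ... | no  _ | no  _           = v

    private
      matching-P : u ∈ P → matching u ≡ to f u
      matching-P {u = u} u∈P with u ∈? P
      ... | yes _   = refl
      ... | no u∉P = contradiction u∈P u∉P

      matching-to : u ∈ P → matching (to f u) ≡ u
      matching-to {u = u} u∈P with to f u ∈? P | hasPreimage? (to f u)
      ... | yes fu∈P | _                  = contradiction (to-∈ f u∈P) (P∩Q=∅ fu∈P)
      ... | no  _    | yes (u′ , u′∈P , e) = to-injective f u′∈P u∈P e
      ... | no  _    | no  ∄u              = contradiction (u , u∈P , refl) ∄u

      matching-fixed : v ∉ P → ¬ HasPreimage v → matching v ≡ v
      matching-fixed {v = v} v∉P ∄u with v ∈? P | hasPreimage? v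
      ... | yes v∈P | _             = contradiction v∈P v∉P
      ... | no  _   | yes preimage = contradiction preimage ∄u
      ... | no  _   | no  _        = refl

    matching-involutive : ∀ v → matching (matching v) ≡ v
    matching-involutive v = by-cases v (v ∈? P) (hasPreimage? v)
      where
      by-cases : ∀ v → Dec (v ∈ P) → Dec (HasPreimage v) → matching (matching v) ≡ v
      by-cases v (yes v∈P) _ = trans (cong matching (matching-P v∈P)) (matching-to v∈P)
      by-cases _ (no _) (yes (u , u∈P , refl)) = trans (cong matching (matching-to u∈P)) (matching-P u∈P)
      by-cases v (no v∉P) (no ∄u) = trans (cong matching (matching-fixed v∉P ∄u)) (matching-fixed v∉P ∄u)

    matching-edge : ∀ v → matching v ≢ v → Adj G v (matching v) × (v ∈ P ⊎ v ∈ Q)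
    matching-edge v = by-cases v (v ∈? P) (hasPreimage? v)
      where
      by-cases : ∀ v → Dec (v ∈ P) → Dec (HasPreimage v) →
        matching v ≢ v → Adj G v (matching v) × (v ∈ P ⊎ v ∈ Q)
      by-cases v (yes v∈P) _ _ = subst (Adj G v) (≡.sym (matching-P v∈P)) (to-adj f v∈P) , inj₁ v∈P
      by-cases _ (no _) (yes (u , u∈P , refl)) _ =
        subst (Adj G (to f u)) (≡.sym (matching-to u∈P)) (Adj-sym (to-adj f u∈P)) , inj₂ (to-∈ f u∈P)
      by-cases v (no v∉P) (no ∄u) moved = contradiction (matching-fixed v∉P ∄u) moved

    ∣P∣+∣P∣≤∣Saturated∣ : ∣ P ∣ + ∣ P ∣ ≤ ∣ Saturated G matching ∣
    ∣P∣+∣P∣≤∣Saturated∣ = begin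
      ∣ P ∣ + ∣ P ∣                   ≤⟨ +-mono-≤ (p⊆q⇒∣p∣≤∣q∣ P⊆M∩P)
                                                  (injective⇒∣p∣≤∣q∣ (to f) to∈M─P (to-injective f)) ⟩
      ∣ M ∩ P ∣ + ∣ M ─ P ∣           ≡⟨ ≡.sym (∣p∣≡∣p∩q∣+∣p─q∣ M P) ⟩
      ∣ M ∣                           ∎
      where
      open ≤-Reasoning
      M = Saturated G matching
      P⊆M∩P : P ⊆ M ∩ P
      P⊆M∩P u∈P = x∈p∩q⁺ (∈Saturated⁺ moved , u∈P)
        where
        moved = λ e → P∩Q=∅ u∈P (subst (_∈ Q) (trans (≡.sym (matching-P u∈P)) e) (to-∈ f u∈P))
      to∈M─P : u ∈ P → to f u ∈ M ─ P
      to∈M─P u∈P = x∈p∧x∉q⇒x∈p─q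
        (∈Saturated⁺ (λ e → P∩Q=∅ u∈P (subst (_∈ Q) (trans (≡.sym e) (matching-to u∈P)) (to-∈ f u∈P))))
        (λ fu∈P → P∩Q=∅ fu∈P (to-∈ f u∈P))

module _ (G : Graph n) (I : Subset n) (μ : Fin n → Fin n)
         (maxI : MaxCritical G I) (maxμ : IsMaximumMatchingOfL G I μ) where

  private
    indI = proj₁ (proj₁ maxI)
    μ-involutive = proj₁ (proj₁ maxμ)
    μ-edge = proj₂ (proj₁ maxμ)
    S = Saturated G μ

    μ-injective : μ u ≡ μ v → u ≡ v
    μ-injective {u = u} {v} e = trans (≡.sym (μ-involutive u)) (trans (cong μ e) (μ-involutive v))

  matched-I⇒N : u ∈ I → u ∈ S → μ u ∈ N G I
  matched-I⇒N {u = u} u∈I u∈S with μ-edge u (∈Saturated⁻ G u∈S)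
  ... | uμu , _ , inj₁ μu∈I  = contradiction uμu (indI u (μ u) u∈I μu∈I)
  ... | _   , _ , inj₂ μu∈NI = μu∈NI

  S─NI⊆I : S ─ N G I ⊆ I
  S─NI⊆I {v} v∈S─NI with μ-edge v (∈Saturated⁻ G (p─q⊆p S _ v∈S─NI))
  ... | _ , inj₁ v∈I  , _ = v∈I
  ... | _ , inj₂ v∈NI , _ = contradiction v∈NI (x∈p─q⇒x∉q v∈S─NI)

  ∣NI∣+∣NI∣≤∣S∣ : ∣ N G I ∣ + ∣ N G I ∣ ≤ ∣ S ∣
  ∣NI∣+∣NI∣≤∣S∣ = ≤-trans (∣P∣+∣P∣≤∣Saturated∣ G f NI∩I=∅)
                          (proj₂ maxμ ν (matching-involutive G f NI∩I=∅ , ν-edge))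
    where
    f = hall G (critical⇒hall G (proj₁ maxI))
    NI∩I=∅ : ∀ {v} → v ∈ N G I → v ∉ I
    NI∩I=∅ v∈NI v∈I = independent⇒∉N G indI v∈I v∈NI
    ν = matching G f NI∩I=∅
    inL : ∀ {v} → ν v ≢ v → InL G I v
    inL {v} moved = Sum.swap (proj₂ (matching-edge G f NI∩I=∅ v moved))
    ν-edge : ∀ v → ν v ≢ v → Adj G v (ν v) × InL G I v × InL G I (ν v)
    ν-edge v moved = proj₁ (matching-edge G f NI∩I=∅ v moved) , inL moved ,
      inL (λ e → moved (trans (≡.sym e) (matching-involutive G f NI∩I=∅ v)))

  ∣NI∣≤∣I∩S∣ : ∣ N G I ∣ ≤ ∣ I ∩ S ∣
  ∣NI∣≤∣I∩S∣ = +-cancelˡ-≤ ∣ N G I ∣ _ _ (begin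
    ∣ N G I ∣ + ∣ N G I ∣      ≤⟨ ∣NI∣+∣NI∣≤∣S∣ ⟩
    ∣ S ∣                      ≡⟨ ∣p∣≡∣p∩q∣+∣p─q∣ S (N G I) ⟩
    ∣ S ∩ N G I ∣ + ∣ S ─ N G I ∣ ≤⟨ +-mono-≤ (p⊆q⇒∣p∣≤∣q∣ (p∩q⊆q S _)) (p⊆q⇒∣p∣≤∣q∣ S─NI⊆I∩S) ⟩
    ∣ N G I ∣ + ∣ I ∩ S ∣      ∎)
    where
    open ≤-Reasoning
    S─NI⊆I∩S : S ─ N G I ⊆ I ∩ S
    S─NI⊆I∩S v∈ = x∈p∩q⁺ (S─NI⊆I v∈ , p─q⊆p S _ v∈)

  ∣I∩S∣≤∣NI∣ : ∣ I ∩ S ∣ ≤ ∣ N G I ∣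
  ∣I∩S∣≤∣NI∣ = injective⇒∣p∣≤∣q∣ μ (λ u∈ → let u∈I , u∈S = x∈p∩q⁻ I S u∈ in matched-I⇒N u∈I u∈S)
    (λ _ _ → μ-injective)

  ∣I∩S∣≡∣NI∣ : ∣ I ∩ S ∣ ≡ ∣ N G I ∣
  ∣I∩S∣≡∣NI∣ = ≤-antisym ∣I∩S∣≤∣NI∣ ∣NI∣≤∣I∩S∣

  μ-maps-NI─J-into-J : MaxCritical G J → v ∈ N G I → v ∉ J → μ v ∈ J
  μ-maps-NI─J-into-J {J = J} maxJ v∈NI v∉J =
    ∈preimage⁻ μ (p∩q⊆q _ _ (p⊆q∧∣q∣≤∣p∣⇒q⊆p (p∩q⊆p _ _) ∣NI─J∣≤∣W∣ (x∈p∧x∉q⇒x∈p─q v∈NI v∉J)))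
    where
    open ≤-Reasoning
    indJ = proj₁ (proj₁ maxJ)
    W = (N G I ─ J) ∩ preimage μ J
    into : u ∈ J ∩ (I ∩ S) → μ u ∈ W
    into {u} u∈ = let u∈J , u∈I∩S = x∈p∩q⁻ J (I ∩ S) u∈ ; u∈I , u∈S = x∈p∩q⁻ I S u∈I∩S in
      x∈p∩q⁺ (x∈p∧x∉q⇒x∈p─q (matched-I⇒N u∈I u∈S)
                (λ μu∈J → indJ u (μ u) u∈J μu∈J (proj₁ (μ-edge u (∈Saturated⁻ G u∈S))))
             , ∈preimage⁺ μ (subst (_∈ J) (≡.sym (μ-involutive u)) u∈J))
    ∣J∩I∩S∣≤∣W∣ : ∣ J ∩ (I ∩ S) ∣ ≤ ∣ W ∣
    ∣J∩I∩S∣≤∣W∣ = injective⇒∣p∣≤∣q∣ μ into (λ _ _ → μ-injective)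
    J─NI⊆ : J ─ N G I ⊆ (J ∩ (I ∩ S)) ∪ (I ─ S)
    J─NI⊆ {u} u∈J─NI with critical⊆L G maxI (proj₁ maxJ) (p─q⊆p J _ u∈J─NI) | u ∈? S
    ... | inj₂ u∈NI | _       = contradiction u∈NI (x∈p─q⇒x∉q u∈J─NI)
    ... | inj₁ u∈I  | yes u∈S = x∈p∪q⁺ (inj₁ (x∈p∩q⁺ (p─q⊆p J _ u∈J─NI , x∈p∩q⁺ (u∈I , u∈S))))
    ... | inj₁ u∈I  | no  u∉S = x∈p∪q⁺ (inj₂ (x∈p∧x∉q⇒x∈p─q u∈I u∉S))
    ∣J─NI∣≤∣J∩I∩S∣+∣I─S∣ : ∣ J ─ N G I ∣ ≤ ∣ J ∩ (I ∩ S) ∣ + ∣ I ─ S ∣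
    ∣J─NI∣≤∣J∩I∩S∣+∣I─S∣ = ≤-trans (p⊆q⇒∣p∣≤∣q∣ J─NI⊆) (∣p∪q∣≤∣p∣+∣q∣ (J ∩ (I ∩ S)) _)
    ∣NI─J∣≤∣W∣ : ∣ N G I ─ J ∣ ≤ ∣ W ∣
    ∣NI─J∣≤∣W∣ = +-cancelʳ-≤ ∣ I ─ S ∣ _ _ (+-cancelˡ-≤ ∣ N G I ∩ J ∣ _ _ (begin
      ∣ N G I ∩ J ∣ + (∣ N G I ─ J ∣ + ∣ I ─ S ∣) ≡⟨ ≡.sym (+-assoc ∣ N G I ∩ J ∣ _ _) ⟩
      (∣ N G I ∩ J ∣ + ∣ N G I ─ J ∣) + ∣ I ─ S ∣ ≡⟨ cong (_+ ∣ I ─ S ∣) (≡.sym (∣p∣≡∣p∩q∣+∣p─q∣ (N G I) J)) ⟩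
      ∣ N G I ∣ + ∣ I ─ S ∣                       ≡⟨ cong (_+ ∣ I ─ S ∣) (≡.sym ∣I∩S∣≡∣NI∣) ⟩
      ∣ I ∩ S ∣ + ∣ I ─ S ∣                       ≡⟨ ≡.sym (∣p∣≡∣p∩q∣+∣p─q∣ I S) ⟩
      ∣ I ∣                                       ≡⟨ maxCritical-∣∣≡ G maxI maxJ ⟩
      ∣ J ∣                                       ≡⟨ ∣p∣≡∣p∩q∣+∣p─q∣ J (N G I) ⟩
      ∣ J ∩ N G I ∣ + ∣ J ─ N G I ∣               ≤⟨ +-monoʳ-≤ _ ∣J─NI∣≤∣J∩I∩S∣+∣I─S∣ ⟩
      ∣ J ∩ N G I ∣ + (∣ J ∩ (I ∩ S) ∣ + ∣ I ─ S ∣) ≤⟨ +-monoʳ-≤ ∣ J ∩ N G I ∣ (+-monoˡ-≤ ∣ I ─ S ∣ ∣J∩I∩S∣≤∣W∣) ⟩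
      ∣ J ∩ N G I ∣ + (∣ W ∣ + ∣ I ─ S ∣)         ≡⟨ cong (λ A → ∣ A ∣ + (∣ W ∣ + ∣ I ─ S ∣)) (∩-comm J (N G I)) ⟩
      ∣ N G I ∩ J ∣ + (∣ W ∣ + ∣ I ─ S ∣)         ∎))

  μ-maps-N-into-maxCritical : MaxCritical G J → v ∈ N G I →
    ¬ (InCorona G v × ¬ InBoundaryL G I v) → μ v ∈ J
  μ-maps-N-into-maxCritical {J = J} {v = v} maxJ v∈NI ¬interior with v ∈? J
  ... | no  v∉J = μ-maps-NI─J-into-J maxJ v∈NI v∉J
  ... | yes v∈J = contradiction (critical⊆corona G (proj₁ maxJ) v∈J , ¬boundary) ¬interior
    where
    ¬boundary : ¬ InBoundaryL G I v
    ¬boundary (_ , w , vw , w∉L) = w∉L (N-maxCritical⊆L G maxI maxJ (∈N⁺ G v∈J vw))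

mainTheorem5 : {n : ℕ} (G : Graph n) (I : Subset n) → MaxCritical G I →
    (μ : Fin n → Fin n) → IsMaximumMatchingOfL G I μ →
    ∀ v → InImage G μ (λ x → x ∈ N G I × ¬ (InCorona G x × ¬ InBoundaryL G I x)) v ⊎ InKer G v →
    InNucleus G v
mainTheorem5 G I maxI μ maxμ v (inj₂ v∈ker) J maxJ = v∈ker J (proj₁ maxJ)
mainTheorem5 G I maxI μ maxμ _ (inj₁ (x , (x∈NI , ¬interior) , refl)) J maxJ =
  μ-maps-N-into-maxCritical G I μ maxI maxμ maxJ x∈NI ¬interior
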